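{- For every $k\ge 2$, every separable permutation is a sub-pattern of some $k$-fractal; that is, the family of $k$-fractals is a basis for the family of separable permutations.
   Context: A pattern of size $\ell$ is $p:[\ell]^2\to2$; a sub-pattern of $p$ is a pattern $q(a,b)=p(i_a,i_b)$ for some $i_0<\dots<i_{m-1}<\ell$. A permutation $\pi$ of $\{0,\dots,\ell-1\}$ is identified with the pattern $p_\pi(x,y)=0$ iff $\pi(x)<\pi(y)$. Direct sum $(\pi\oplus\sigma)(x)=\pi(x)$ for $x<m$, $\sigma(x-m)+m$ otherwise; skew sum $(\pi\ominus\sigma)(x)=\pi(x)+n$ for $x<m$, $\sigma(x-m)$ otherwise ($m,n$ sizes of $\pi,\sigma$). A permutation is separable if obtained from the one-element permutation by direct and skew sums. The $k$-fractal of dimension $0$ is the one-element permutation; if $p_n$ is the $k$-fractal of dimension $n$, the $k$-fractal of dimension $n+1$ is the direct sum $p_n\oplus\dots\oplus p_n$ of $k$ copies of $p_n$ if $n$ is even, and the skew sum $p_n\ominus\dots\ominus p_n$ of $k$ copies if $n$ is odd. -}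

module Defs where

open import Data.Bool using (Bool; true; false; if_then_else_)
open import Data.Nat using (ℕ; zero; suc; _+_; _*_; _^_; _<ᵇ_)
open import Data.Nat.Properties using (+-comm)
open import Data.Fin using (Fin; toℕ; splitAt; _↑ˡ_; _↑ʳ_; cast; _<_)
open import Data.Sum using ([_,_])
open import Data.Product using (Σ; _×_)
open import Relation.Binary.PropositionalEquality using (_≡_)

-- A pattern of size ℓ: p : [ℓ]² → 2  (2 = Bool, false = 0, true = 1)
Pattern : ℕ → Set
Pattern ℓ = Fin ℓ → Fin ℓ → Bool

SubPattern : ∀ {m ℓ} → Pattern m → Pattern ℓ → Set
SubPattern {m} {ℓ} q p =
  Σ (Fin m → Fin ℓ) λ i →
    (∀ a b → a < b → i a < i b) × (∀ a b → q a b ≡ p (i a) (i b))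

-- Maps {0..ℓ-1} → {0..ℓ-1}; permutations are those that are bijective.
-- (All maps built below by ⊕, ⊖ from the one-element permutation are bijections.)
Perm : ℕ → Set
Perm ℓ = Fin ℓ → Fin ℓ

pattern-of : ∀ {ℓ} → Perm ℓ → Pattern ℓ
pattern-of π x y = if toℕ (π x) <ᵇ toℕ (π y) then false else true

one : Perm 1
one x = x

empty : Perm 0
empty ()

_⊕_ : ∀ {m n} → Perm m → Perm n → Perm (m + n)
_⊕_ {m} {n} π σ x = [ (λ a → π a ↑ˡ n) , (λ b → m ↑ʳ σ b) ] (splitAt m x)

_⊖_ : ∀ {m n} → Perm m → Perm n → Perm (m + n)
_⊖_ {m} {n} π σ x =
  [ (λ a → cast (+-comm n m) (n ↑ʳ π a)) , (λ b → cast (+-comm n m) (σ b ↑ˡ m)) ]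
    (splitAt m x)

data SepTree : ℕ → Set where
  leaf : SepTree 1
  dsum : ∀ {m n} → SepTree m → SepTree n → SepTree (m + n)
  ssum : ∀ {m n} → SepTree m → SepTree n → SepTree (m + n)

⟦_⟧ : ∀ {n} → SepTree n → Perm n
⟦ leaf ⟧ = one
⟦ dsum s t ⟧ = ⟦ s ⟧ ⊕ ⟦ t ⟧
⟦ ssum s t ⟧ = ⟦ s ⟧ ⊖ ⟦ t ⟧

Separable : ∀ {n} → Perm n → Set
Separable {n} π = Σ (SepTree n) λ t → ∀ x → ⟦ t ⟧ x ≡ π x

-- k copies combined: p ⊕ (p ⊕ (… ⊕ p)) ; the trailing empty summand is the
-- identity for ⊕/⊖ (it only contributes the size  m + 0).
⊕-copies : ∀ {m} (k : ℕ) → Perm m → Perm (k * m)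
⊕-copies zero p = empty
⊕-copies (suc k) p = p ⊕ ⊕-copies k p

⊖-copies : ∀ {m} (k : ℕ) → Perm m → Perm (k * m)
⊖-copies zero p = empty
⊖-copies (suc k) p = p ⊖ ⊖-copies k p

even : ℕ → Bool
even zero = true
even (suc n) = if even n then false else true

fractal : (k d : ℕ) → Perm (k ^ d)
fractal k zero = one
fractal k (suc d) = if even d then ⊕-copies k (fractal k d) else ⊖-copies k (fractal k d)

-- Pattern containment ≼ is monotone for ⊕ and ⊖: read through splitAt, the
-- order relation of π ⊕ σ (or π ⊖ σ) is a block matrix with the relations of π
-- and σ on the diagonal and constants off it, and so is the order of the
-- positions themselves; a blockwise index map preserves both. Each fractal is the
-- first summand of the next one, so fractals grow along ≼ with the dimension.
-- Given σ ≼ fractal d₁ and τ ≼ fractal d₂, both embed in the fractal of some even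
-- D ≥ d₁ + d₂, and as k ≥ 2 the fractal of dimension D + 1 starts with
-- fractal D ⊕ fractal D ≽ σ ⊕ τ; skew sums use an odd D instead.
module Submission where

open import Defs
open import Data.Nat using (ℕ; _≤_)
open import Data.Product using (Σ)

open import Data.Bool using (Bool; true; false; T; if_then_else_)
open import Data.Bool.Properties using (T-≡)
open import Data.Nat as ℕ using (zero; suc; _+_; _<ᵇ_; _≤′_; ≤′-refl; ≤′-step; s≤s)
open import Data.Nat.Properties
  using (<⇒<ᵇ; <ᵇ⇒<; ≤⇒≤′; ≤-refl; ≤-trans; <⇒≤; m≤m+n; m≤n+m; n≤1+n)
open import Data.Fin using (Fin; toℕ; splitAt; join; _↑ˡ_; _↑ʳ_)
open import Data.Fin.Properties
  using (toℕ<n; toℕ-↑ˡ; toℕ-↑ʳ; toℕ-cast; splitAt-↑ˡ; splitAt-join; join-splitAt)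
open import Data.Sum using (_⊎_; inj₁; inj₂; [_,_]; map)
open import Data.Product using (∃-syntax; _×_; _,_)
open import Function using (_∘_; _on_; id; Equivalence)
open import Relation.Binary.Definitions using (Reflexive)
open import Relation.Binary.PropositionalEquality
  using (_≡_; refl; sym; trans; cong; cong₂; subst; subst₂)

private
  variable
    m n m' n' : ℕ
    A A' B B' V : Set

+-cancelˡ-<ᵇ : ∀ m x y → (m + x <ᵇ m + y) ≡ (x <ᵇ y)
+-cancelˡ-<ᵇ zero    x y = refl
+-cancelˡ-<ᵇ (suc m) x y = +-cancelˡ-<ᵇ m x y

<⇒<ᵇ≡true : ∀ {x y} → x ℕ.< y → (x <ᵇ y) ≡ true
<⇒<ᵇ≡true = Equivalence.to T-≡ ∘ <⇒<ᵇ

≤⇒<ᵇ≡false : ∀ {x y} → y ≤ x → (x <ᵇ y) ≡ false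
≤⇒<ᵇ≡false {y = zero}  _         = refl
≤⇒<ᵇ≡false {y = suc y} (s≤s y≤x) = ≤⇒<ᵇ≡false y≤x

block : V → V → (A → A → V) → (B → B → V) → (A ⊎ B → A ⊎ B → V)
block u v R S (inj₁ a) (inj₁ a') = R a a'
block u v R S (inj₁ a) (inj₂ b)  = u
block u v R S (inj₂ b) (inj₁ a)  = v
block u v R S (inj₂ b) (inj₂ b') = S b b'

Preserves : (V → V → Set) → (A → A → V) → (B → B → V) → (A → B) → Set
Preserves _∼_ R S f = ∀ a a' → R a a' ∼ S (f a) (f a')

block-map : ∀ (_∼_ : V → V → Set) {u v R R' S S'} {i : A → A'} {j : B → B'} →
  Reflexive _∼_ → Preserves _∼_ R R' i → Preserves _∼_ S S' j →
  Preserves _∼_ (block u v R S) (block u v R' S') (map i j)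
block-map _∼_ ∼-refl pi pj (inj₁ a) (inj₁ a') = pi a a'
block-map _∼_ ∼-refl pi pj (inj₁ a) (inj₂ b)  = ∼-refl
block-map _∼_ ∼-refl pi pj (inj₂ b) (inj₁ a)  = ∼-refl
block-map _∼_ ∼-refl pi pj (inj₂ b) (inj₂ b') = pj b b'

<ᵇ-on-lower-upper : (f : A → ℕ) (g : B → ℕ) → (∀ a → f a ℕ.< m) → ∀ s t →
  (_<ᵇ_ on [ f , (m +_) ∘ g ]) s t ≡ block true false (_<ᵇ_ on f) (_<ᵇ_ on g) s t
<ᵇ-on-lower-upper {m = m} f g f<m (inj₁ a) (inj₁ a') = refl
<ᵇ-on-lower-upper {m = m} f g f<m (inj₁ a) (inj₂ b)  =
  <⇒<ᵇ≡true (≤-trans (f<m a) (m≤m+n m (g b)))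
<ᵇ-on-lower-upper {m = m} f g f<m (inj₂ b) (inj₁ a)  =
  ≤⇒<ᵇ≡false (≤-trans (<⇒≤ (f<m a)) (m≤m+n m (g b)))
<ᵇ-on-lower-upper {m = m} f g f<m (inj₂ b) (inj₂ b') = +-cancelˡ-<ᵇ m (g b) (g b')

<ᵇ-on-upper-lower : (f : A → ℕ) (g : B → ℕ) → (∀ b → g b ℕ.< n) → ∀ s t →
  (_<ᵇ_ on [ (n +_) ∘ f , g ]) s t ≡ block false true (_<ᵇ_ on f) (_<ᵇ_ on g) s t
<ᵇ-on-upper-lower {n = n} f g g<n (inj₁ a) (inj₁ a') = +-cancelˡ-<ᵇ n (f a) (f a')
<ᵇ-on-upper-lower {n = n} f g g<n (inj₁ a) (inj₂ b)  =
  ≤⇒<ᵇ≡false (≤-trans (<⇒≤ (g<n b)) (m≤m+n n (f a)))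
<ᵇ-on-upper-lower {n = n} f g g<n (inj₂ b) (inj₁ a)  =
  <⇒<ᵇ≡true (≤-trans (g<n b) (m≤m+n n (f a)))
<ᵇ-on-upper-lower {n = n} f g g<n (inj₂ b) (inj₂ b') = refl

toℕ-splitAt : ∀ m (x : Fin (m + n)) → toℕ x ≡ [ toℕ , (m +_) ∘ toℕ ] (splitAt m x)
toℕ-splitAt {n} m x = trans (cong toℕ (sym (join-splitAt m n x))) (toℕ-join (splitAt m x))
  where
  toℕ-join : ∀ s → toℕ (join m n s) ≡ [ toℕ , (m +_) ∘ toℕ ] s
  toℕ-join (inj₁ a) = toℕ-↑ˡ a n
  toℕ-join (inj₂ b) = toℕ-↑ʳ m b

module _ (π : Perm m) (σ : Perm n) where

  toℕ-⊕ : ∀ x → toℕ ((π ⊕ σ) x) ≡ [ toℕ ∘ π , (m +_) ∘ toℕ ∘ σ ] (splitAt m x)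
  toℕ-⊕ x with splitAt m x
  ... | inj₁ a = toℕ-↑ˡ (π a) n
  ... | inj₂ b = toℕ-↑ʳ m (σ b)

  toℕ-⊖ : ∀ x → toℕ ((π ⊖ σ) x) ≡ [ (n +_) ∘ toℕ ∘ π , toℕ ∘ σ ] (splitAt m x)
  toℕ-⊖ x with splitAt m x
  ... | inj₁ a = trans (toℕ-cast _ (n ↑ʳ π a)) (toℕ-↑ʳ n (π a))
  ... | inj₂ b = trans (toℕ-cast _ (σ b ↑ˡ m)) (toℕ-↑ˡ (σ b) m)

below : Perm m → Fin m → Fin m → Bool
below π = _<ᵇ_ on (toℕ ∘ π)

_<ᶠ_ : Fin m → Fin m → Bool
_<ᶠ_ = _<ᵇ_ on toℕ

BlockShaped : ∀ m → V → V → (Fin m → Fin m → V) → (Fin n → Fin n → V) →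
  (Fin (m + n) → Fin (m + n) → V) → Set
BlockShaped m u v R S X = ∀ x y → X x y ≡ block u v R S (splitAt m x) (splitAt m y)

<ᶠ-blockShaped : ∀ m → BlockShaped {n = n} m true false _<ᶠ_ _<ᶠ_ _<ᶠ_
<ᶠ-blockShaped m x y =
  trans (cong₂ _<ᵇ_ (toℕ-splitAt m x) (toℕ-splitAt m y))
        (<ᵇ-on-lower-upper toℕ toℕ toℕ<n (splitAt m x) (splitAt m y))

below-⊕-blockShaped : (π : Perm m) (σ : Perm n) →
  BlockShaped m true false (below π) (below σ) (below (π ⊕ σ))
below-⊕-blockShaped {m} π σ x y =
  trans (cong₂ _<ᵇ_ (toℕ-⊕ π σ x) (toℕ-⊕ π σ y))
        (<ᵇ-on-lower-upper _ _ (toℕ<n ∘ π) (splitAt m x) (splitAt m y))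

below-⊖-blockShaped : (π : Perm m) (σ : Perm n) →
  BlockShaped m false true (below π) (below σ) (below (π ⊖ σ))
below-⊖-blockShaped {m} π σ x y =
  trans (cong₂ _<ᵇ_ (toℕ-⊖ π σ x) (toℕ-⊖ π σ y))
        (<ᵇ-on-upper-lower _ _ (toℕ<n ∘ σ) (splitAt m x) (splitAt m y))

_⊞_ : (Fin m → Fin m') → (Fin n → Fin n') → Fin (m + n) → Fin (m' + n')
_⊞_ {m} {m'} {n} {n'} i j = join m' n' ∘ map i j ∘ splitAt m

⊞-preserves : ∀ (_∼_ : V → V → Set) {u v R R' S S' X Y}
  {i : Fin m → Fin m'} {j : Fin n → Fin n'} →
  Reflexive _∼_ → BlockShaped m u v R S X → BlockShaped m' u v R' S' Y →
  Preserves _∼_ R R' i → Preserves _∼_ S S' j → Preserves _∼_ X Y (i ⊞ j)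
⊞-preserves {m = m} {m'} {n' = n'} _∼_ {u} {v} {R' = R'} {S' = S'} {i = i} {j}
  ∼-refl X-shape Y-shape pi pj x y =
  subst₂ _∼_ (sym (X-shape x y))
             (sym (trans (Y-shape _ _) (cong₂ (block u v R' S') (splitAt-⊞ x) (splitAt-⊞ y))))
             (block-map _∼_ ∼-refl pi pj (splitAt m x) (splitAt m y))
  where
  splitAt-⊞ : ∀ x → splitAt m' ((i ⊞ j) x) ≡ map i j (splitAt m x)
  splitAt-⊞ x = splitAt-join m' n' (map i j (splitAt m x))

blockShaped-↑ˡ : ∀ {u v : V} {R S X} → BlockShaped {n = n} m u v R S X →
  ∀ a a' → X (a ↑ˡ n) (a' ↑ˡ n) ≡ R a a'
blockShaped-↑ˡ {n = n} {m} {u = u} {v} {R} {S} X-shape a a' =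
  trans (X-shape _ _) (cong₂ (block u v R S) (splitAt-↑ˡ m a n) (splitAt-↑ˡ m a' n))

-- Both orders are tested with _<ᵇ_, as in pattern-of, so that monotonicity and
-- order preservation of the index map are two instances of ⊞-preserves.
_⇒ᵀ_ : Bool → Bool → Set
u ⇒ᵀ v = T u → T v

infix 4 _≼_

record _≼_ (π : Perm m) (σ : Perm n) : Set where
  field
    idx       : Fin m → Fin n
    idx-mono  : Preserves _⇒ᵀ_ _<ᶠ_ _<ᶠ_ idx
    idx-below : Preserves _≡_ (below π) (below σ) idx

open _≼_

≼-refl : (π : Perm m) → π ≼ π
≼-refl π = record { idx = id ; idx-mono = λ _ _ → id ; idx-below = λ _ _ → refl }

≼-trans : {π : Perm m} {σ : Perm n} {τ : Perm m'} → π ≼ σ → σ ≼ τ → π ≼ τ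
≼-trans e f = record
  { idx       = idx f ∘ idx e
  ; idx-mono  = λ a a' → idx-mono f _ _ ∘ idx-mono e a a'
  ; idx-below = λ a a' → trans (idx-below e a a') (idx-below f _ _)
  }

≼-of-upper-block : ∀ {u v S} {π : Perm m} {τ : Perm (m + n)} →
  BlockShaped m u v (below π) S (below τ) → π ≼ τ
≼-of-upper-block {m} X-shape = record
  { idx       = _↑ˡ _
  ; idx-mono  = λ a a' → subst T (sym (blockShaped-↑ˡ (<ᶠ-blockShaped m) a a'))
  ; idx-below = λ a a' → sym (blockShaped-↑ˡ X-shape a a')
  }

≼-of-blocks : ∀ {u v} {π : Perm m} {σ : Perm n} {π' : Perm m'} {σ' : Perm n'} {τ τ'} →
  BlockShaped m u v (below π) (below σ) (below τ) →
  BlockShaped m' u v (below π') (below σ') (below τ') →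
  π ≼ π' → σ ≼ σ' → τ ≼ τ'
≼-of-blocks {m} {m' = m'} τ-shape τ'-shape e f = record
  { idx       = idx e ⊞ idx f
  ; idx-mono  = ⊞-preserves _⇒ᵀ_ id (<ᶠ-blockShaped m) (<ᶠ-blockShaped m')
                             (idx-mono e) (idx-mono f)
  ; idx-below = ⊞-preserves _≡_ refl τ-shape τ'-shape (idx-below e) (idx-below f)
  }

≼-respˡ-≗ : {π π' : Perm m} {σ : Perm n} → (∀ x → π x ≡ π' x) → π ≼ σ → π' ≼ σ
≼-respˡ-≗ π≗π' e = record
  { idx       = idx e
  ; idx-mono  = idx-mono e
  ; idx-below = λ a a' →
      trans (cong₂ (_<ᵇ_ on toℕ) (sym (π≗π' a)) (sym (π≗π' a'))) (idx-below e a a')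
  }

≼⇒SubPattern : {π : Perm m} {σ : Perm n} → π ≼ σ → SubPattern (pattern-of π) (pattern-of σ)
≼⇒SubPattern e =
  idx e ,
  (λ a a' a<a' → <ᵇ⇒< _ _ (idx-mono e a a' (<⇒<ᵇ a<a'))) ,
  (λ a a' → cong (λ c → if c then false else true) (idx-below e a a'))

π≼π⊕σ : (π : Perm m) (σ : Perm n) → π ≼ π ⊕ σ
π≼π⊕σ π σ = ≼-of-upper-block (below-⊕-blockShaped π σ)

π≼π⊖σ : (π : Perm m) (σ : Perm n) → π ≼ π ⊖ σ
π≼π⊖σ π σ = ≼-of-upper-block (below-⊖-blockShaped π σ)

⊕-mono-≼ : {π : Perm m} {σ : Perm n} {π' : Perm m'} {σ' : Perm n'} →
  π ≼ π' → σ ≼ σ' → π ⊕ σ ≼ π' ⊕ σ'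
⊕-mono-≼ {π = π} {σ} {π'} {σ'} =
  ≼-of-blocks (below-⊕-blockShaped π σ) (below-⊕-blockShaped π' σ')

⊖-mono-≼ : {π : Perm m} {σ : Perm n} {π' : Perm m'} {σ' : Perm n'} →
  π ≼ π' → σ ≼ σ' → π ⊖ σ ≼ π' ⊖ σ'
⊖-mono-≼ {π = π} {σ} {π'} {σ'} =
  ≼-of-blocks (below-⊖-blockShaped π σ) (below-⊖-blockShaped π' σ')

π≼⊕-copies : ∀ j (π : Perm m) → π ≼ ⊕-copies (suc j) π
π≼⊕-copies j π = π≼π⊕σ π (⊕-copies j π)

π≼⊖-copies : ∀ j (π : Perm m) → π ≼ ⊖-copies (suc j) π
π≼⊖-copies j π = π≼π⊖σ π (⊖-copies j π)

π⊕π≼⊕-copies : ∀ j (π : Perm m) → π ⊕ π ≼ ⊕-copies (2 + j) π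
π⊕π≼⊕-copies j π = ⊕-mono-≼ (≼-refl π) (π≼⊕-copies j π)

π⊖π≼⊖-copies : ∀ j (π : Perm m) → π ⊖ π ≼ ⊖-copies (2 + j) π
π⊖π≼⊖-copies j π = ⊖-mono-≼ (≼-refl π) (π≼⊖-copies j π)

parity-above : ∀ b d → ∃[ D ] d ≤ D × even D ≡ b
parity-above b d with even d in eq | b
... | true  | true  = d , ≤-refl , eq
... | false | false = d , ≤-refl , eq
... | true  | false = suc d , n≤1+n d , cong (λ e → if e then false else true) eq
... | false | true  = suc d , n≤1+n d , cong (λ e → if e then false else true) eq

module _ (j : ℕ) where

  private
    k = 2 + j

  fractal-≼-suc : ∀ d → fractal k d ≼ fractal k (suc d)
  fractal-≼-suc d with even d
  ... | true  = π≼⊕-copies (suc j) (fractal k d)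
  ... | false = π≼⊖-copies (suc j) (fractal k d)

  fractal-mono : ∀ {d D} → d ≤ D → fractal k d ≼ fractal k D
  fractal-mono = go ∘ ≤⇒≤′
    where
    go : ∀ {d D} → d ≤′ D → fractal k d ≼ fractal k D
    go {d} ≤′-refl                = ≼-refl (fractal k d)
    go {D = suc D} (≤′-step d≤D) = ≼-trans (go d≤D) (fractal-≼-suc D)

  fractal⊕fractal≼fractal : ∀ d → even d ≡ true →
    fractal k d ⊕ fractal k d ≼ fractal k (suc d)
  fractal⊕fractal≼fractal d even-d rewrite even-d = π⊕π≼⊕-copies j (fractal k d)

  fractal⊖fractal≼fractal : ∀ d → even d ≡ false →
    fractal k d ⊖ fractal k d ≼ fractal k (suc d)
  fractal⊖fractal≼fractal d odd-d rewrite odd-d = π⊖π≼⊖-copies j (fractal k d)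

  common-fractal : ∀ {π : Perm m} {σ : Perm n} b →
    ∃[ d ] π ≼ fractal k d → ∃[ d ] σ ≼ fractal k d →
    ∃[ D ] even D ≡ b × π ≼ fractal k D × σ ≼ fractal k D
  common-fractal b (d₁ , π≼) (d₂ , σ≼) =
    let D , d₁+d₂≤D , even-D = parity-above b (d₁ + d₂)
    in  D , even-D , ≼-trans π≼ (fractal-mono (≤-trans (m≤m+n d₁ d₂) d₁+d₂≤D))
                   , ≼-trans σ≼ (fractal-mono (≤-trans (m≤n+m d₂ d₁) d₁+d₂≤D))

  separable≼fractal : (t : SepTree n) → ∃[ d ] ⟦ t ⟧ ≼ fractal k d
  separable≼fractal leaf = 0 , ≼-refl one
  separable≼fractal (dsum s t) =
    let D , even-D , s≼ , t≼ = common-fractal true (separable≼fractal s) (separable≼fractal t)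
    in  suc D , ≼-trans (⊕-mono-≼ s≼ t≼) (fractal⊕fractal≼fractal D even-D)
  separable≼fractal (ssum s t) =
    let D , odd-D , s≼ , t≼ = common-fractal false (separable≼fractal s) (separable≼fractal t)
    in  suc D , ≼-trans (⊖-mono-≼ s≼ t≼) (fractal⊖fractal≼fractal D odd-D)

proposition4p5 : (k : ℕ) → 2 ≤ k → (n : ℕ) (π : Perm n) → Separable π →
    Σ ℕ λ d → SubPattern (pattern-of π) (pattern-of (fractal k d))
proposition4p5 .(2 + j) (s≤s (s≤s {n = j} _)) _ _ (t , ⟦t⟧≗π) =
  let d , ⟦t⟧≼fractal = separable≼fractal j t
  in  d , ≼⇒SubPattern (≼-respˡ-≗ ⟦t⟧≗π ⟦t⟧≼fractal)
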